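{- $f(3,q)\ge q^{q-o(q)}$; that is, there is a function $g$ with $g(q)/q\to 0$ as $q\to\infty$ such that $f(3,q)\ge q^{q-g(q)}$ for all $q\ge 2$.
   Context: A word over an alphabet is a finite string of letters; a subword of $w$ is a string of consecutive letters of $w$. A word $w$ contains a pattern $P$ if there is a map assigning to each letter of $P$ a nonempty word (different letters may receive equal words) such that the word obtained from $P$ by replacing each letter by its assigned word is a subword of $w$. The Zimin word $Z_3$ is $x_1x_2x_1x_3x_1x_2x_1$. $f(3,q)$ denotes the smallest integer such that every word of length $f(3,q)$ over an alphabet of size $q$ contains $Z_3$. -}

module Defs where

open import Data.Nat using (ℕ; _≤_; _*_; _∸_; _^_)
open import Data.Fin using (Fin; zero; suc)
open import Data.List using (List; []; _∷_; _++_; concatMap; length)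
open import Data.Product using (Σ; ∃; _×_)
open import Relation.Binary.PropositionalEquality using (_≡_; _≢_)

Contains : ∀ {q k : ℕ} → List (Fin q) → List (Fin k) → Set
Contains {q} {k} w P =
  Σ (Fin k → List (Fin q)) λ σ →
    ((i : Fin k) → σ i ≢ []) ×
    ∃ λ u → ∃ λ v → w ≡ u ++ concatMap σ P ++ v

Z₃ : List (Fin 3)
Z₃ = x1 ∷ x2 ∷ x1 ∷ x3 ∷ x1 ∷ x2 ∷ x1 ∷ []
  where
  x1 x2 x3 : Fin 3
  x1 = zero
  x2 = suc zero
  x3 = suc (suc zero)

AllContainZ₃ : ℕ → ℕ → Set
AllContainZ₃ q n = (w : List (Fin q)) → length w ≡ n → Contains w Z₃

IsF3 : ℕ → ℕ → Set
IsF3 q n = AllContainZ₃ q n × ((m : ℕ) → AllContainZ₃ q m → n ≤ m)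

-- g(q)/q → 0 as q → ∞ : for every k ≥ 1, eventually k·g(q) ≤ q
LittleO-id : (ℕ → ℕ) → Set
LittleO-id g = (k : ℕ) → 1 ≤ k → ∃ λ N → (q : ℕ) → N ≤ q → k * g q ≤ q

-- Call the gap of an occurrence of a letter y the subword between it and the next
-- occurrence of y.  In an image A B A C A B A of Z₃, the first letter a of A has the same
-- gap (the part of A B A before its next a) after the first and after the third A, so a
-- word in which no letter recurs with the same gap avoids Z₃.  Over the letters 0 … s such
-- a word of length (s + 1)! is 0 P₁ 0 P₂ … 0 Pₘ with P₁, …, Pₘ the permutations of 1 … s
-- in lexicographic order: the gaps of 0 are the Pᵢ, and a letter x of Pᵢ has the gap
-- (suffix of Pᵢ after x) 0 (prefix of Pᵢ₊₁ before x); since a lexicographic successor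
-- step replaces a decreasing tail by a larger letter followed by an increasing tail, such
-- gaps never repeat.  Hence f(3, q) > q!, and q! ≥ (d + 1) ^ (q - d) with d ≈ q / K for a
-- large constant K gives q! ≥ q ^ (q - o(q)).

module Submission where

open import Defs
open import Data.Nat using (ℕ; _≤_; _∸_; _^_)
open import Data.Product using (Σ; _×_)

open import Data.Empty using (⊥; ⊥-elim)
open import Data.Fin using (Fin; zero; suc) renaming (_<_ to _<ᶠ_)
open import Data.Fin.Properties using ()
  renaming (_≟_ to _≟ᶠ_; <-isStrictPartialOrder to <ᶠ-isStrictPartialOrder; <⇒≢ to <ᶠ⇒≢)
open import Data.List
  using (List; []; _∷_; _++_; [_]; _∷ʳ_; length; map; concatMap; reverse; tabulate; take; drop; initLast; _∷ʳ′_)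
open import Data.List.Properties
  using ( ++-assoc; ++-identityʳ; ++-monoid; ∷-injective; ∷ʳ-++; map-++; map-∘; concatMap-++
        ; length-++; length-++-sucʳ; length-map; length-tabulate; length-take
        ; reverse-++; unfold-reverse; take++drop≡id)
open import Data.List.Membership.Propositional using (_∈_; _∉_; lose; find)
open import Data.List.Membership.Propositional.Properties
  using (∈-++⁺ˡ; ∈-++⁺ʳ; ∈-++⁻; ∈-insert; ∈-map⁺; ∈-map⁻; ∈-concatMap⁻; ∈-tabulate⁻)
open import Data.List.Relation.Binary.Disjoint.Propositional using (Disjoint)
open import Data.List.Relation.Binary.Permutation.Propositional
  using (_↭_; ↭-refl; ↭-prep; ↭-trans; ↭-sym; ↭⇒↭ₛ)
open import Data.List.Relation.Binary.Permutation.Propositional.Properties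
  using (All-resp-↭; ∈-resp-↭; ↭-length; ↭-reverse; shift)
import Data.List.Relation.Binary.Permutation.Setoid.Properties as ↭ₛ
open import Data.List.Relation.Binary.Subset.Propositional using (_⊆_)
open import Data.List.Relation.Unary.All using (All; []; _∷_)
import Data.List.Relation.Unary.All as All
open import Data.List.Relation.Unary.All.Properties as All using (All¬⇒¬Any; ¬Any⇒All¬)
open import Data.List.Relation.Unary.AllPairs as AllPairs using (AllPairs; []; _∷_)
import Data.List.Relation.Unary.AllPairs.Properties as AllPairs
open import Data.List.Relation.Unary.Any using (Any; here; there)
open import Data.List.Relation.Unary.Linked using (Linked; []; [-]; _∷_)
import Data.List.Relation.Unary.Linked as Linked
import Data.List.Relation.Unary.Linked.Properties as Linked
open import Data.List.Relation.Unary.Linked.Properties using (AllPairs⇒Linked)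
open import Data.List.Relation.Unary.Unique.Propositional using (Unique)
import Data.List.Relation.Unary.Unique.Propositional.Properties as Unique
open import Data.Nat using (zero; suc; _+_; _*_; _<_; _≤?_; z≤n; s≤s; s<s; _!; NonZero)
open import Data.Nat.DivMod using (_/_; _%_; m≡m%n+[m/n]*n; m%n<n; m/n*n≤m; /-monoˡ-≤; m*n/n≡m)
open import Data.Nat.Properties
  using ( suc-injective; <-cmp; 0≢1+n; +-cancelʳ-≡; ≤-refl; ≤-trans; ≤-pred; ≤-reflexive; <⇒≤; ≰⇒>
        ; m≤n⇒m≤1+n; m≤n⇒m<n∨m≡n; m≤m+n; m≤n*m; m≤n⇒m⊓n≡m; 1≤n!; m^n>0
        ; *-comm; *-suc; *-identityʳ; *-distribˡ-+; *-distribʳ-+; [m*n]*[o*p]≡[m*o]*[n*p]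
        ; +-mono-≤; +-monoˡ-≤; *-mono-≤; *-monoˡ-≤; *-monoʳ-≤
        ; ^-monoˡ-≤; ^-monoʳ-≤; ^-distribˡ-+-*; ^-*-assoc
        ; n∸n≡0; +-∸-assoc; ∸-+-assoc; m+[n∸m]≡n; m+n∸n≡m; m∸n≤m; m∸[m∸n]≡n; ∸-monoˡ-≤; ∸-monoʳ-≤
        ; module ≤-Reasoning)
import Data.Product as Product
open import Data.Product using (∃; ∃₂; _,_; proj₁; proj₂)
open import Data.Sum using (_⊎_; inj₁; inj₂)
open import Function using (flip; _∘_)
open import Relation.Binary.Core using (Rel)
open import Relation.Binary.Definitions using (DecidableEquality; tri<; tri≈; tri>)
open import Relation.Binary.PropositionalEquality
  using (_≡_; refl; sym; trans; cong; cong₂; subst; subst₂; setoid; module ≡-Reasoning)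
open import Relation.Binary.Structures using (IsStrictPartialOrder)
open import Relation.Nullary using (¬_; yes; no; contradiction)

private
  variable
    A X : Set
    x y : A
    xs ys : List A

++-injective-length : ∀ (a c : List A) {b d} → length a ≡ length c → a ++ b ≡ c ++ d → a ≡ c × b ≡ d
++-injective-length []      []      _   eq = refl , eq
++-injective-length (x ∷ a) (y ∷ c) |a| eq with refl , eq′ ← ∷-injective eq
  with refl , b≡d ← ++-injective-length a c (suc-injective |a|) eq′ = refl , b≡d

++-split-< : ∀ (a : List A) {y b} c {d} → length a < length c → a ++ y ∷ b ≡ c ++ d →
             ∃ λ m → c ≡ a ++ y ∷ m × b ≡ m ++ d
++-split-< []      (_ ∷ c) _       eq with refl , eq′ ← ∷-injective eq = c , refl , eq′
++-split-< (x ∷ a) (_ ∷ c) (s≤s a<c) eq with refl , eq′ ← ∷-injective eq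
  with m , refl , b≡ ← ++-split-< a c a<c eq′ = m , refl , b≡

++-∷-injective-∉ : ∀ (a c : List A) {b d} → x ∉ a → x ∉ c → a ++ x ∷ b ≡ c ++ x ∷ d → a ≡ c × b ≡ d
++-∷-injective-∉ []      []      _   _   eq = refl , proj₂ (∷-injective eq)
++-∷-injective-∉ []      (y ∷ c) _   x∉c eq = ⊥-elim (x∉c (here (proj₁ (∷-injective eq))))
++-∷-injective-∉ (y ∷ a) []      x∉a _   eq = ⊥-elim (x∉a (here (sym (proj₁ (∷-injective eq)))))
++-∷-injective-∉ (y ∷ a) (_ ∷ c) x∉a x∉c eq with refl , eq′ ← ∷-injective eq
  with refl , b≡d ← ++-∷-injective-∉ a c (x∉a ∘ there) (x∉c ∘ there) eq′ = refl , b≡d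

length-delete : ∀ (p : List A) {a s k} → length (p ++ a ∷ s) ≡ suc k → length (p ++ s) ≡ k
length-delete p {a} {s} eq = suc-injective (trans (sym (length-++-sucʳ p a s)) eq)

length-∷ʳ : ∀ (xs : List A) x → length (xs ∷ʳ x) ≡ suc (length xs)
length-∷ʳ xs x = trans (length-++-sucʳ xs x []) (cong (suc ∘ length) (++-identityʳ xs))

length-++-cancelʳ : ∀ (a c : List A) {ys} → length (a ++ ys) ≡ length (c ++ ys) → length a ≡ length c
length-++-cancelʳ a c eq = +-cancelʳ-≡ _ _ _ (trans (sym (length-++ a)) (trans eq (length-++ c)))

length-concatMap-const : ∀ (f : X → List A) {c} xs → All (λ x → length (f x) ≡ c) xs →
                         length (concatMap f xs) ≡ length xs * c
length-concatMap-const f []       []          = refl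
length-concatMap-const f (x ∷ xs) (|fx| ∷ |f|) =
  trans (length-++ (f x)) (cong₂ _+_ |fx| (length-concatMap-const f xs |f|))

Linked-∷ʳ-++ : ∀ {ℓ} {R : Rel A ℓ} xs {x y ys} → Linked R (xs ∷ʳ x) → R x y → Linked R (y ∷ ys) →
               Linked R (xs ++ x ∷ y ∷ ys)
Linked-∷ʳ-++ []           _         Rxy Rys = Rxy ∷ Rys
Linked-∷ʳ-++ (_ ∷ [])     (R₁ ∷ _)  Rxy Rys = R₁ ∷ Rxy ∷ Rys
Linked-∷ʳ-++ (_ ∷ _ ∷ xs) (R₁ ∷ Rs) Rxy Rys = R₁ ∷ Linked-∷ʳ-++ (_ ∷ xs) Rs Rxy Rys

module _ {ℓ} {R : Rel A ℓ} where

  AllPairs-++-∷⁻ : ∀ xs → AllPairs R (xs ++ y ∷ ys) → All (R y) ys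
  AllPairs-++-∷⁻ []       (Ry ∷ _) = Ry
  AllPairs-++-∷⁻ (_ ∷ xs) (_ ∷ Rs) = AllPairs-++-∷⁻ xs Rs

  AllPairs-delete : ∀ xs → AllPairs R (xs ++ y ∷ ys) → AllPairs R (xs ++ ys)
  AllPairs-delete []       (_ ∷ Rs)   = Rs
  AllPairs-delete (_ ∷ xs) (Rx ∷ Rs) with Rx₁ , _ ∷ Rx₂ ← All.++⁻ xs Rx =
    All.++⁺ Rx₁ Rx₂ ∷ AllPairs-delete xs Rs

  AllPairs-reverse : AllPairs R xs → AllPairs (flip R) (reverse xs)
  AllPairs-reverse {[]}     []        = []
  AllPairs-reverse {x ∷ xs} (Rx ∷ Rs) rewrite unfold-reverse x xs =
    AllPairs.++⁺ (AllPairs-reverse Rs) ([] ∷ [])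
      (All.map (_∷ []) (All-resp-↭ (↭-sym (↭-reverse xs)) Rx))

Unique-∷ : x ∉ xs → Unique xs → Unique (x ∷ xs)
Unique-∷ x∉ u = ¬Any⇒All¬ _ x∉ ∷ u

Unique-∷⁻ : Unique (x ∷ xs) → x ∉ xs
Unique-∷⁻ (x≢ ∷ _) = All¬⇒¬Any x≢

Unique-++⁻ʳ : ∀ xs → Unique (xs ++ ys) → Unique ys
Unique-++⁻ʳ []       u       = u
Unique-++⁻ʳ (_ ∷ xs) (_ ∷ u) = Unique-++⁻ʳ xs u

Unique-++⇒Disjoint : ∀ xs → Unique (xs ++ ys) → Disjoint xs ys
Unique-++⇒Disjoint (x ∷ xs) (x≢ ∷ _) (here refl  , y∈ys) = All¬⇒¬Any x≢ (∈-++⁺ʳ xs y∈ys)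
Unique-++⇒Disjoint (x ∷ xs) (_ ∷ u)  (there y∈xs , y∈ys) = Unique-++⇒Disjoint xs u (y∈xs , y∈ys)

tail-⊆ : ∀ u {x : A} {w v} → Unique (u ++ x ∷ w) → u ++ x ∷ w ⊆ u ++ x ∷ v → w ⊆ v
tail-⊆ u uniq ⊆ {h} h∈w with ∈-++⁻ u (⊆ (∈-++⁺ʳ u (there h∈w)))
... | inj₁ h∈u        = ⊥-elim (Unique-++⇒Disjoint u uniq (h∈u , there h∈w))
... | inj₂ (here refl) = ⊥-elim (Unique-∷⁻ (Unique-++⁻ʳ u uniq) h∈w)
... | inj₂ (there h∈v) = h∈v

Unique-resp-↭ : {A : Set} {xs ys : List A} → xs ↭ ys → Unique xs → Unique ys
Unique-resp-↭ {A} p = ↭ₛ.Unique-resp-↭ (setoid A) (↭⇒↭ₛ p)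

module Gaps {A : Set} (_≟_ : DecidableEquality A) where

  open import Data.List.Membership.DecPropositional _≟_ using (_∈?_)

  before : A → List A → List A
  before x []       = []
  before x (y ∷ ys) with y ≟ x
  ... | yes _ = []
  ... | no  _ = y ∷ before x ys

  gaps : List A → List (A × List A)
  gaps []       = []
  gaps (y ∷ ys) with y ∈? ys
  ... | yes _ = (y , before y ys) ∷ gaps ys
  ... | no  _ = gaps ys

  before-++ˡ : ∀ {x} p {L} → x ∉ p → before x (p ++ L) ≡ p ++ before x L
  before-++ˡ {x} []      _   = refl
  before-++ˡ {x} (y ∷ p) x∉ with y ≟ x
  ... | yes refl = ⊥-elim (x∉ (here refl))
  ... | no  _    = cong (y ∷_) (before-++ˡ p (x∉ ∘ there))

  before-++ʳ : ∀ {x L} r → x ∈ L → before x (L ++ r) ≡ before x L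
  before-++ʳ {x} {y ∷ L} r x∈ with y ≟ x | x∈
  ... | yes _  | _          = refl
  ... | no y≢x | here refl  = ⊥-elim (y≢x refl)
  ... | no _   | there x∈L  = cong (y ∷_) (before-++ʳ r x∈L)

  before-split : ∀ {x L} → x ∈ L → ∃ λ w → L ≡ before x L ++ x ∷ w
  before-split {x} {y ∷ L} x∈ with y ≟ x | x∈
  ... | yes refl | _         = L , refl
  ... | no y≢x   | here refl = ⊥-elim (y≢x refl)
  ... | no _     | there x∈L with w , eq ← before-split x∈L = w , cong (y ∷_) eq

  before-++-∷ : ∀ {x} p {r} → x ∉ p → before x (p ++ x ∷ r) ≡ p
  before-++-∷ {x} [] _ with x ≟ x
  ... | yes _   = refl
  ... | no  x≢x = ⊥-elim (x≢x refl)
  before-++-∷ {x} (y ∷ p) x∉ with y ≟ x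
  ... | yes refl = ⊥-elim (x∉ (here refl))
  ... | no  _    = cong (y ∷_) (before-++-∷ p (x∉ ∘ there))

  gaps-∈ : ∀ {y ys} → y ∈ ys → gaps (y ∷ ys) ≡ (y , before y ys) ∷ gaps ys
  gaps-∈ {y} {ys} y∈ with y ∈? ys
  ... | yes _  = refl
  ... | no y∉ = ⊥-elim (y∉ y∈)

  gaps-++ : ∀ u w → ∃ λ ps → gaps (u ++ w) ≡ ps ++ gaps w
  gaps-++ []      w = [] , refl
  gaps-++ (y ∷ u) w with y ∈? (u ++ w) | gaps-++ u w
  ... | yes _ | ps , eq = (y , before y (u ++ w)) ∷ ps , cong (_ ∷_) eq
  ... | no  _ | ps , eq = ps , eq

  gaps-unique : ∀ {w} → Unique w → gaps w ≡ []
  gaps-unique {[]}    _ = refl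
  gaps-unique {y ∷ w} u with y ∈? w
  ... | yes y∈ = ⊥-elim (Unique-∷⁻ u y∈)
  ... | no  _  = gaps-unique (Unique-++⁻ʳ [ y ] u)

  ∈-gaps : ∀ u {y w} → y ∈ w → (y , before y w) ∈ gaps (u ++ y ∷ w)
  ∈-gaps u {y} {w} y∈ with ps , eq ← gaps-++ u (y ∷ w) rewrite eq | gaps-∈ y∈ = ∈-++⁺ʳ ps (here refl)

  -- In x T C x T the two occurrences of x followed by T have the same gap.
  repeated-gap : ∀ u {x T} C v → x ∈ T → ¬ Unique (gaps (u ++ x ∷ T ++ C ++ x ∷ T ++ v))
  repeated-gap u {x} {T} C v x∈T uniq = Unique-∷⁻ (Unique-++⁻ʳ ps (subst Unique first-gap uniq)) second-gap
    where
    R = C ++ x ∷ T ++ v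
    ps = proj₁ (gaps-++ u (x ∷ T ++ R))
    first-gap : gaps (u ++ x ∷ T ++ R) ≡ ps ++ (x , before x T) ∷ gaps (T ++ R)
    first-gap = begin
      gaps (u ++ x ∷ T ++ R)                       ≡⟨ proj₂ (gaps-++ u (x ∷ T ++ R)) ⟩
      ps ++ gaps (x ∷ T ++ R)                      ≡⟨ cong (ps ++_) (gaps-∈ (∈-++⁺ˡ x∈T)) ⟩
      ps ++ (x , before x (T ++ R)) ∷ gaps (T ++ R) ≡⟨ cong (λ g → ps ++ (x , g) ∷ gaps (T ++ R)) (before-++ʳ R x∈T) ⟩
      ps ++ (x , before x T) ∷ gaps (T ++ R)       ∎
      where open ≡-Reasoning
    second-gap : (x , before x T) ∈ gaps (T ++ R)
    second-gap = subst₂ (λ g w → (x , g) ∈ gaps w) (before-++ʳ v x∈T) (++-assoc T C (x ∷ T ++ v))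
                   (∈-gaps (T ++ C) (∈-++⁺ˡ x∈T))

unique-gaps⇒¬Z₃ : ∀ {q} (w : List (Fin q)) → Unique (Gaps.gaps _≟ᶠ_ w) → ¬ Contains w Z₃
unique-gaps⇒¬Z₃ w uniq (σ , σ≢[] , u , v , w≡) with σ zero | σ≢[] zero
... | []     | []≢[] = []≢[] refl
... | a ∷ A′ | _     = Gaps.repeated-gap _≟ᶠ_ u C v a∈T (subst (Unique ∘ Gaps.gaps _≟ᶠ_) (trans w≡ Z₃-shape) uniq)
  where
  B = σ (suc zero)
  C = σ (suc (suc zero))
  T = A′ ++ B ++ a ∷ A′
  a∈T : a ∈ T
  a∈T = ∈-++⁺ʳ A′ (∈-++⁺ʳ B (here refl))
  Z₃-shape : u ++ ((a ∷ A′) ++ B ++ (a ∷ A′) ++ C ++ (a ∷ A′) ++ B ++ (a ∷ A′) ++ []) ++ v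
           ≡ u ++ a ∷ T ++ C ++ a ∷ T ++ v
  Z₃-shape = solve 6 (λ u v A B C a →
    u ⊕ ((a ⊕ A) ⊕ B ⊕ (a ⊕ A) ⊕ C ⊕ (a ⊕ A) ⊕ B ⊕ (a ⊕ A) ⊕ id) ⊕ v
      ⊜ u ⊕ a ⊕ (A ⊕ B ⊕ a ⊕ A) ⊕ C ⊕ a ⊕ (A ⊕ B ⊕ a ⊕ A) ⊕ v) refl u v A′ B C [ a ]
    where open import Algebra.Solver.Monoid (++-monoid (Fin _))

module Lex {A : Set} {ℓ} {_≺_ : Rel A ℓ} (≺-isStrictPartialOrder : IsStrictPartialOrder _≡_ _≺_) where

  open IsStrictPartialOrder ≺-isStrictPartialOrder using (irrefl) renaming (trans to ≺-trans)

  ≺-irrefl : ∀ {x} → ¬ x ≺ x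
  ≺-irrefl = irrefl refl

  infix 4 _<ₗ_ _≤ₗ_

  data _<ₗ_ : List A → List A → Set ℓ where
    this : ∀ {x y xs ys} → x ≺ y → x ∷ xs <ₗ y ∷ ys
    next : ∀ {x xs ys} → xs <ₗ ys → x ∷ xs <ₗ x ∷ ys

  _≤ₗ_ : List A → List A → Set ℓ
  xs ≤ₗ ys = xs ≡ ys ⊎ xs <ₗ ys

  <ₗ-irrefl : ∀ {xs} → ¬ xs <ₗ xs
  <ₗ-irrefl (this x≺x) = ≺-irrefl x≺x
  <ₗ-irrefl (next p)   = <ₗ-irrefl p

  <ₗ-trans : ∀ {xs ys zs} → xs <ₗ ys → ys <ₗ zs → xs <ₗ zs
  <ₗ-trans (this p) (this q) = this (≺-trans p q)
  <ₗ-trans (this p) (next _) = this p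
  <ₗ-trans (next _) (this q) = this q
  <ₗ-trans (next p) (next q) = next (<ₗ-trans p q)

  <ₗ-≤ₗ-trans : ∀ {xs ys zs} → xs <ₗ ys → ys ≤ₗ zs → xs <ₗ zs
  <ₗ-≤ₗ-trans p (inj₁ refl) = p
  <ₗ-≤ₗ-trans p (inj₂ q)    = <ₗ-trans p q

  ≤ₗ-common-prefix : ∀ p {a m b} → p ++ a ≤ₗ m → m ≤ₗ p ++ b → ∃ λ c → m ≡ p ++ c
  ≤ₗ-common-prefix []      {m = m} _ _ = m , refl
  ≤ₗ-common-prefix (y ∷ p) {a} (inj₁ refl) _           = a , refl
  ≤ₗ-common-prefix (y ∷ p) {b = b} (inj₂ _) (inj₁ refl) = b , refl
  ≤ₗ-common-prefix (y ∷ p) (inj₂ (this y≺h)) (inj₂ (this h≺y)) = ⊥-elim (≺-irrefl (≺-trans y≺h h≺y))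
  ≤ₗ-common-prefix (y ∷ p) (inj₂ (this y≺y)) (inj₂ (next _))   = ⊥-elim (≺-irrefl y≺y)
  ≤ₗ-common-prefix (y ∷ p) (inj₂ (next _))   (inj₂ (this y≺y)) = ⊥-elim (≺-irrefl y≺y)
  ≤ₗ-common-prefix (y ∷ p) (inj₂ (next l₁))  (inj₂ (next l₂))
    with c , refl ← ≤ₗ-common-prefix p (inj₂ l₁) (inj₂ l₂) = c , refl

  -- The shape of two consecutive permutations in lexicographic order:
  -- the decreasing tail c ∷ β is replaced by c′ ∷ β′ with c ≺ c′ and β′ increasing.
  data Successor : List A → List A → Set ℓ where
    step : ∀ α {c c′ β β′} → c ≺ c′ → AllPairs (flip _≺_) β → AllPairs _≺_ β′ →
           Successor (α ++ c ∷ β) (α ++ c′ ∷ β′)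

  Successor⇒<ₗ : ∀ {B B′} → Successor B B′ → B <ₗ B′
  Successor⇒<ₗ (step []      c≺c′ _ _) = this c≺c′
  Successor⇒<ₗ (step (a ∷ α) c≺c′ β↘ β′↗) = next (Successor⇒<ₗ (step α c≺c′ β↘ β′↗))

  Successor-∷ : ∀ {a B B′} → Successor B B′ → Successor (a ∷ B) (a ∷ B′)
  Successor-∷ {a} (step α c≺c′ β↘ β′↗) = step (a ∷ α) c≺c′ β↘ β′↗

  Successor-prefix : ∀ {B B′ ρ u x v w} → Successor B B′ → B ≡ ρ ++ x ∷ v → B′ ≡ u ++ x ∷ w →
                     length ρ ≡ length u → Any (_∈ v) w → ρ ≡ u
  Successor-prefix {ρ = ρ} {u} {x} {v} {w} (step α c≺c′ β↘ β′↗) B≡ B′≡ |ρ|≡|u| shared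
    with <-cmp (length α) (length u)
  ... | tri< α<u _ _ with _ , h∈w , h∈v ← find shared =
    ⊥-elim (≺-irrefl (≺-trans (All.lookup x≺w h∈w) (All.lookup v≺x h∈v)))
    where
    β≡ = proj₂ (proj₂ (++-split-< α ρ (subst (length α <_) (sym |ρ|≡|u|) α<u) B≡))
    β′≡ = proj₂ (proj₂ (++-split-< α u α<u B′≡))
    v≺x : All (_≺ x) v
    v≺x = AllPairs-++-∷⁻ _ (subst (AllPairs (flip _≺_)) β≡ β↘)
    x≺w : All (x ≺_) w
    x≺w = AllPairs-++-∷⁻ _ (subst (AllPairs _≺_) β′≡ β′↗)
  ... | tri≈ _ α≡u _
    with _ , c∷β≡ ← ++-injective-length α ρ (trans α≡u (sym |ρ|≡|u|)) B≡
       | _ , c′∷β′≡ ← ++-injective-length α u α≡u B′≡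
    with refl , _ ← ∷-injective c∷β≡ | refl , _ ← ∷-injective c′∷β′≡ = ⊥-elim (≺-irrefl c≺c′)
  ... | tri> _ _ u<α
    with m , α≡ρxm , _ ← ++-split-< ρ α (subst (_< length α) (sym |ρ|≡|u|) u<α) (sym B≡)
       | m′ , α≡uxm′ , _ ← ++-split-< u α u<α (sym B′≡) =
    proj₁ (++-injective-length ρ u |ρ|≡|u| (trans (sym α≡ρxm) α≡uxm′))

module Permutations {A : Set} where

  picks : List A → List (A × List A)
  picks []       = []
  picks (x ∷ xs) = (x , xs) ∷ map (Product.map₂ (x ∷_)) (picks xs)

  permutations : ℕ → List A → List (List A)
  permutationsWithHead : ℕ → A × List A → List (List A)

  permutations zero    _  = [ [] ]
  permutations (suc k) xs = concatMap (permutationsWithHead k) (picks xs)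

  permutationsWithHead k (a , r) = map (a ∷_) (permutations k r)

  map-proj₁-picks : ∀ xs → map proj₁ (picks xs) ≡ xs
  map-proj₁-picks []       = refl
  map-proj₁-picks (x ∷ xs) = cong (x ∷_) (trans (sym (map-∘ (picks xs))) (map-proj₁-picks xs))

  ∈-picks⁻ : ∀ {xs a r} → (a , r) ∈ picks xs → ∃₂ λ p s → xs ≡ p ++ a ∷ s × r ≡ p ++ s
  ∈-picks⁻ {x ∷ xs} (here refl) = [] , xs , refl , refl
  ∈-picks⁻ {x ∷ xs} (there q∈)
    with _ , q∈′ , refl ← ∈-map⁻ (Product.map₂ (x ∷_)) q∈
    with p , s , refl , refl ← ∈-picks⁻ q∈′ = x ∷ p , s , refl , refl

  picks-∷ʳ : ∀ xs x → ∃ λ ps → picks (xs ∷ʳ x) ≡ ps ∷ʳ (x , xs)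
  picks-∷ʳ []       x = [] , refl
  picks-∷ʳ (y ∷ xs) x with ps , eq ← picks-∷ʳ xs x =
    (y , xs ∷ʳ x) ∷ map (Product.map₂ (y ∷_)) ps ,
    cong ((y , xs ∷ʳ x) ∷_) (trans (cong (map _) eq) (map-++ _ ps _))

  ∈-permutations⇒↭ : ∀ k {xs P} → length xs ≡ k → P ∈ permutations k xs → P ↭ xs
  ∈-permutations⇒↭ zero {[]} _ (here refl) = ↭-refl
  ∈-permutations⇒↭ (suc k) {xs} |xs| P∈
    with (a , r) , ar∈ , P∈′ ← find (∈-concatMap⁻ (permutationsWithHead k) {xs = picks xs} P∈)
    with P′ , P′∈ , refl ← ∈-map⁻ (a ∷_) P∈′
    with p , s , refl , refl ← ∈-picks⁻ ar∈ =
    ↭-trans (↭-prep a (∈-permutations⇒↭ k (length-delete p |xs|) P′∈))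
            (↭-sym (shift a p s))

  length-permutations : ∀ k {xs} → length xs ≡ k → length (permutations k xs) ≡ k !
  length-permutations zero    _            = refl
  length-permutations (suc k) {xs} |xs| = begin
    length (concatMap (permutationsWithHead k) (picks xs)) ≡⟨ length-concatMap-const _ (picks xs) (All.tabulate |group|) ⟩
    length (picks xs) * k !                              ≡⟨ cong (_* k !) (trans (sym (length-map proj₁ (picks xs))) (cong length (map-proj₁-picks xs))) ⟩
    length xs * k !                                      ≡⟨ cong (_* k !) |xs| ⟩
    suc k * k !                                          ∎
    where
    open ≡-Reasoning
    |group| : ∀ {q} → q ∈ picks xs → length (permutationsWithHead k q) ≡ k !
    |group| {a , r} q∈ with p , s , refl , refl ← ∈-picks⁻ q∈ =
      trans (length-map (a ∷_) (permutations k (p ++ s)))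
            (length-permutations k (length-delete p |xs|))

  permutations-head : ∀ k {xs} → length xs ≡ k → ∃ λ R → permutations k xs ≡ xs ∷ R
  permutations-head zero    {[]}     _ = [] , refl
  permutations-head (suc k) {x ∷ xs} |xs| with R , eq ← permutations-head k (suc-injective |xs|) =
    _ , cong (λ P → map (x ∷_) P ++ concatMap (permutationsWithHead k) (map (Product.map₂ (x ∷_)) (picks xs))) eq

  permutations-last : ∀ k {xs} → length xs ≡ k → ∃ λ R → permutations k xs ≡ R ∷ʳ reverse xs
  permutations-last zero    {[]} _ = [] , refl
  permutations-last (suc k) {xs} |xs| with initLast xs
  ... | []       = ⊥-elim (0≢1+n |xs|)
  ... | ys ∷ʳ′ y
    with ps , picks≡ ← picks-∷ʳ ys y
       | R , perms≡ ← permutations-last k {ys} (suc-injective (trans (sym (length-∷ʳ ys y)) |xs|)) =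
    concatMap G ps ++ map (y ∷_) R , (begin
      concatMap G (picks (ys ∷ʳ y))                  ≡⟨ cong (concatMap G) picks≡ ⟩
      concatMap G (ps ∷ʳ (y , ys))                   ≡⟨ concatMap-++ G ps _ ⟩
      concatMap G ps ++ G (y , ys) ++ []             ≡⟨ cong (concatMap G ps ++_) (++-identityʳ _) ⟩
      concatMap G ps ++ map (y ∷_) (permutations k ys) ≡⟨ cong (λ P → concatMap G ps ++ map (y ∷_) P) perms≡ ⟩
      concatMap G ps ++ map (y ∷_) (R ∷ʳ reverse ys)  ≡⟨ cong (concatMap G ps ++_) (map-++ (y ∷_) R _) ⟩
      concatMap G ps ++ map (y ∷_) R ∷ʳ (y ∷ reverse ys) ≡⟨ ++-assoc (concatMap G ps) _ _ ⟨
      (concatMap G ps ++ map (y ∷_) R) ∷ʳ (y ∷ reverse ys) ≡⟨ cong ((concatMap G ps ++ map (y ∷_) R) ∷ʳ_) (reverse-++ ys [ y ]) ⟨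
      (concatMap G ps ++ map (y ∷_) R) ∷ʳ reverse (ys ∷ʳ y) ∎)
    where
    open ≡-Reasoning
    G = permutationsWithHead k

  module _ {ℓ} {_≺_ : Rel A ℓ} (≺-isStrictPartialOrder : IsStrictPartialOrder _≡_ _≺_) where

    open Lex ≺-isStrictPartialOrder using (Successor; step; Successor-∷)

    linked-permutations : ∀ k {xs} → AllPairs _≺_ xs → length xs ≡ k → Linked Successor (permutations k xs)
    linked-permutations zero    _ _ = [-]
    linked-permutations (suc k) {xs} xs↗ |xs| =
      linked-groups (picks xs) (AllPairs⇒Linked (subst (AllPairs _≺_) (sym (map-proj₁-picks xs)) xs↗))
                    (All.tabulate rest↗)
      where
      Rest↗ : A × List A → Set ℓ
      Rest↗ (_ , r) = AllPairs _≺_ r × length r ≡ k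

      rest↗ : ∀ {q} → q ∈ picks xs → Rest↗ q
      rest↗ {a , r} q∈ with p , s , refl , refl ← ∈-picks⁻ q∈ =
        AllPairs-delete p xs↗ , length-delete p |xs|

      linked-group : ∀ a {r} → AllPairs _≺_ r → length r ≡ k → Linked Successor (permutationsWithHead k (a , r))
      linked-group a r↗ |r| = Linked.map⁺ (Linked.map Successor-∷ (linked-permutations k r↗ |r|))

      linked-groups : ∀ ps → Linked _≺_ (map proj₁ ps) → All Rest↗ ps →
                      Linked Successor (concatMap (permutationsWithHead k) ps)
      linked-groups [] _ _ = []
      linked-groups ((a , r) ∷ []) _ ((r↗ , |r|) ∷ []) =
        subst (Linked Successor) (sym (++-identityʳ _)) (linked-group a r↗ |r|)
      linked-groups ((a , r) ∷ (a′ , r′) ∷ ps) (a≺a′ ∷ as↗) ((r↗ , |r|) ∷ rest@((r′↗ , |r′|) ∷ _))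
        with R , last≡ ← permutations-last k |r| | R′ , head≡ ← permutations-head k |r′| =
        subst (Linked Successor) (sym shape)
          (Linked-∷ʳ-++ (map (a ∷_) R) (subst (Linked Successor) group≡ (linked-group a r↗ |r|))
                        (step [] a≺a′ (AllPairs-reverse r↗) r′↗)
                        (subst (Linked Successor) groups≡ (linked-groups ((a′ , r′) ∷ ps) as↗ rest)))
        where
        Gs = concatMap (permutationsWithHead k) ps
        group≡ : permutationsWithHead k (a , r) ≡ map (a ∷_) R ∷ʳ (a ∷ reverse r)
        group≡ = trans (cong (map (a ∷_)) last≡) (map-++ (a ∷_) R _)
        groups≡ : concatMap (permutationsWithHead k) ((a′ , r′) ∷ ps) ≡ (a′ ∷ r′) ∷ map (a′ ∷_) R′ ++ Gs
        groups≡ = cong (λ P → map (a′ ∷_) P ++ Gs) head≡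
        shape : concatMap (permutationsWithHead k) ((a , r) ∷ (a′ , r′) ∷ ps)
              ≡ map (a ∷_) R ++ (a ∷ reverse r) ∷ (a′ ∷ r′) ∷ map (a′ ∷_) R′ ++ Gs
        shape = trans (cong₂ _++_ group≡ groups≡) (∷ʳ-++ (map (a ∷_) R) _ _)

module BlockWord {A : Set} (_≟_ : DecidableEquality A) {ℓ} {_≺_ : Rel A ℓ}
                 (≺-isStrictPartialOrder : IsStrictPartialOrder _≡_ _≺_)
                 (z : A) {S : List A} (S-unique : Unique S) (z∉S : z ∉ S) where

  open Gaps _≟_
  open Lex ≺-isStrictPartialOrder

  blockWord : List (List A) → List A
  blockWord = concatMap (z ∷_)

  letterGaps : List A → List A → List (A × List A)
  letterGaps B′ []      = []
  letterGaps B′ (x ∷ b) = (x , b ++ z ∷ before x B′) ∷ letterGaps B′ b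

  pairGaps : List A → List A → List (A × List A)
  pairGaps B B′ = (z , B) ∷ letterGaps B′ B

  blockGaps : List (List A) → List (A × List A)
  blockGaps []            = []
  blockGaps (B ∷ [])      = []
  blockGaps (B ∷ B′ ∷ Bs) = pairGaps B B′ ++ blockGaps (B′ ∷ Bs)

  ↭S⇒⊆ : ∀ {P Q} → P ↭ S → Q ↭ S → P ⊆ Q
  ↭S⇒⊆ P↭ Q↭ = ∈-resp-↭ (↭-trans P↭ (↭-sym Q↭))

  ↭S⇒Unique : ∀ {P} → P ↭ S → Unique P
  ↭S⇒Unique P↭ = Unique-resp-↭ (↭-sym P↭) S-unique

  ↭S⇒z∉ : ∀ {P} → P ↭ S → z ∉ P
  ↭S⇒z∉ P↭ z∈ = z∉S (∈-resp-↭ P↭ z∈)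

  ↭S⇒z∉-suffix : ∀ {P ρ x v} → P ↭ S → P ≡ ρ ++ x ∷ v → z ∉ v
  ↭S⇒z∉-suffix {ρ = ρ} P↭ refl z∈ = ↭S⇒z∉ P↭ (∈-++⁺ʳ ρ (there z∈))

  ↭S⇒∈ : ∀ {P Q ρ x v} → P ↭ S → Q ↭ S → P ≡ ρ ++ x ∷ v → x ∈ Q
  ↭S⇒∈ {ρ = ρ} P↭ Q↭ refl = ↭S⇒⊆ P↭ Q↭ (∈-insert ρ)

  gaps-letters : ∀ B {B′ W} → Unique B → z ∉ B → B ⊆ B′ →
                 gaps (B ++ z ∷ B′ ++ W) ≡ letterGaps B′ B ++ gaps (z ∷ B′ ++ W)
  gaps-letters []      _ _ _ = refl
  gaps-letters (x ∷ b) {B′} {W} uniq z∉ B⊆B′ = begin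
    gaps (x ∷ b ++ z ∷ B′ ++ W)                                  ≡⟨ gaps-∈ (∈-++⁺ʳ b (there (∈-++⁺ˡ x∈B′))) ⟩
    (x , before x (b ++ z ∷ B′ ++ W)) ∷ gaps (b ++ z ∷ B′ ++ W)  ≡⟨ cong₂ (λ g gs → (x , g) ∷ gs) gap≡
                                                                      (gaps-letters b (Unique-++⁻ʳ [ x ] uniq) (z∉ ∘ there) (B⊆B′ ∘ there)) ⟩
    (x , b ++ z ∷ before x B′) ∷ letterGaps B′ b ++ gaps (z ∷ B′ ++ W) ∎
    where
    open ≡-Reasoning
    x∈B′ = B⊆B′ (here refl)
    x∉[z] : x ∉ [ z ]
    x∉[z] (here x≡z) = z∉ (here (sym x≡z))
    gap≡ : before x (b ++ z ∷ B′ ++ W) ≡ b ++ z ∷ before x B′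
    gap≡ = trans (before-++ˡ b (Unique-∷⁻ uniq))
                 (cong (b ++_) (trans (before-++ˡ [ z ] x∉[z]) (cong (z ∷_) (before-++ʳ W x∈B′))))

  gaps-blockWord : ∀ Bs → All (_↭ S) Bs → gaps (blockWord Bs) ≡ blockGaps Bs
  gaps-blockWord []       _          = refl
  gaps-blockWord (B ∷ []) (B↭ ∷ []) =
    gaps-unique (subst Unique (sym (++-identityʳ (z ∷ B))) (Unique-∷ (↭S⇒z∉ B↭) (↭S⇒Unique B↭)))
  gaps-blockWord (B ∷ B′ ∷ Bs) (B↭ ∷ Bs↭@(B′↭ ∷ _)) = begin
    gaps (z ∷ B ++ z ∷ B′ ++ W)                                  ≡⟨ gaps-∈ (∈-++⁺ʳ B (here refl)) ⟩
    (z , before z (B ++ z ∷ B′ ++ W)) ∷ gaps (B ++ z ∷ B′ ++ W)  ≡⟨ cong₂ (λ g gs → (z , g) ∷ gs) (before-++-∷ B (↭S⇒z∉ B↭))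
                                                                      (gaps-letters B (↭S⇒Unique B↭) (↭S⇒z∉ B↭) (↭S⇒⊆ B↭ B′↭)) ⟩
    pairGaps B B′ ++ gaps (blockWord (B′ ∷ Bs))                  ≡⟨ cong (pairGaps B B′ ++_) (gaps-blockWord (B′ ∷ Bs) Bs↭) ⟩
    pairGaps B B′ ++ blockGaps (B′ ∷ Bs)                         ∎
    where
    open ≡-Reasoning
    W = blockWord Bs

  map-proj₁-letterGaps : ∀ B′ B → map proj₁ (letterGaps B′ B) ≡ B
  map-proj₁-letterGaps B′ []      = refl
  map-proj₁-letterGaps B′ (x ∷ b) = cong (x ∷_) (map-proj₁-letterGaps B′ b)

  ∈-letterGaps⁻ : ∀ {B′ B e} → e ∈ letterGaps B′ B →
                  ∃ λ ρ → ∃ λ x → ∃ λ v → B ≡ ρ ++ x ∷ v × e ≡ (x , v ++ z ∷ before x B′)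
  ∈-letterGaps⁻ {B = x ∷ b} (here refl) = [] , x , b , refl , refl
  ∈-letterGaps⁻ {B = x ∷ b} (there e∈)
    with ρ , y , v , refl , e≡ ← ∈-letterGaps⁻ e∈ = x ∷ ρ , y , v , refl , e≡

  pairGaps-unique : ∀ {P P′} → P ↭ S → Unique (pairGaps P P′)
  pairGaps-unique {P} {P′} P↭ = Unique.map⁻ (subst Unique (cong (z ∷_) (sym (map-proj₁-letterGaps P′ P)))
                                                      (Unique-∷ (↭S⇒z∉ P↭) (↭S⇒Unique P↭)))

  shared-prefix : ∀ {P₁′ P₂ P₂′ ρ₂ u x v w₁ w₂} → P₁′ ≤ₗ P₂ → P₂ <ₗ P₂′ → P₁′ ↭ S → P₂ ↭ S →
                  P₂ ≡ ρ₂ ++ x ∷ v → P₁′ ≡ u ++ x ∷ w₁ → P₂′ ≡ u ++ x ∷ w₂ → P₂ ≡ u ++ x ∷ v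
  shared-prefix {P₂ = P₂} {ρ₂ = ρ₂} {u} {x} {w₁ = w₁} {w₂} P₁′≤P₂ P₂<P₂′ P₁′↭ P₂↭ P₂≡ P₁′≡ P₂′≡ =
    trans P₂≡uxc (cong (λ t → u ++ x ∷ t) (sym v≡c))
    where
    common = ≤ₗ-common-prefix (u ∷ʳ x) (subst (_≤ₗ P₂) (trans P₁′≡ (sym (∷ʳ-++ u x w₁))) P₁′≤P₂)
                                        (inj₂ (subst (P₂ <ₗ_) (trans P₂′≡ (sym (∷ʳ-++ u x w₂))) P₂<P₂′))
    c = proj₁ common
    P₂≡uxc : P₂ ≡ u ++ x ∷ c
    P₂≡uxc = trans (proj₂ common) (∷ʳ-++ u x c)
    x∉ρ₂ : x ∉ ρ₂
    x∉ρ₂ x∈ = Unique-++⇒Disjoint ρ₂ (subst Unique P₂≡ (↭S⇒Unique P₂↭)) (x∈ , here refl)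
    x∉u : x ∉ u
    x∉u x∈ = Unique-++⇒Disjoint u (subst Unique P₁′≡ (↭S⇒Unique P₁′↭)) (x∈ , here refl)
    v≡c = proj₂ (++-∷-injective-∉ ρ₂ u x∉ρ₂ x∉u (trans (sym P₂≡) P₂≡uxc))

  ↭S-tail-⊆ : ∀ {P Q u x w v} → P ↭ S → Q ↭ S → P ≡ u ++ x ∷ w → Q ≡ u ++ x ∷ v → w ⊆ v
  ↭S-tail-⊆ {u = u} P↭ Q↭ refl refl = tail-⊆ u (↭S⇒Unique P↭) (↭S⇒⊆ P↭ Q↭)

  -- Equal gaps of x in the pairs (P₁, P₁′) and (P₂, P₂′) would mean equal suffixes
  -- after x in P₁, P₂ and equal prefixes before x in P₁′, P₂′.
  no-shared-gap : ∀ {P₁ P₁′ P₂ P₂′ ρ₁ ρ₂ u x v w₁ w₂} →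
                  Successor P₁ P₁′ → P₂ <ₗ P₂′ → P₁′ ≤ₗ P₂ → P₁ ↭ S → P₁′ ↭ S → P₂ ↭ S → P₂′ ↭ S →
                  P₁ ≡ ρ₁ ++ x ∷ v → P₂ ≡ ρ₂ ++ x ∷ v → P₁′ ≡ u ++ x ∷ w₁ → P₂′ ≡ u ++ x ∷ w₂ → ⊥
  no-shared-gap {v = []} {w₂ = []} _ P₂<P₂′ P₁′≤P₂ _ P₁′↭ P₂↭ _ _ P₂≡ P₁′≡ P₂′≡ =
    <ₗ-irrefl (subst (_ <ₗ_) (trans P₂′≡ (sym P₂≡uxv)) P₂<P₂′)
    where P₂≡uxv = shared-prefix P₁′≤P₂ P₂<P₂′ P₁′↭ P₂↭ P₂≡ P₁′≡ P₂′≡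
  no-shared-gap {v = []} {w₂ = h ∷ _} _ P₂<P₂′ P₁′≤P₂ _ P₁′↭ P₂↭ P₂′↭ _ P₂≡ P₁′≡ P₂′≡
    with () ← ↭S-tail-⊆ P₂′↭ P₂↭ P₂′≡ (shared-prefix P₁′≤P₂ P₂<P₂′ P₁′↭ P₂↭ P₂≡ P₁′≡ P₂′≡) (here refl)
  no-shared-gap {ρ₁ = ρ₁} {u = u} {v = h ∷ _} s₁ P₂<P₂′ P₁′≤P₂ P₁↭ P₁′↭ P₂↭ _ P₁≡ P₂≡ P₁′≡ P₂′≡ =
    <ₗ-irrefl (subst (_<ₗ _) P₁≡P₂ (<ₗ-≤ₗ-trans (Successor⇒<ₗ s₁) P₁′≤P₂))
    where
    P₂≡uxv = shared-prefix P₁′≤P₂ P₂<P₂′ P₁′↭ P₂↭ P₂≡ P₁′≡ P₂′≡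
    h∈w₁ = ↭S-tail-⊆ P₂↭ P₁′↭ P₂≡uxv P₁′≡ (here refl)
    |ρ₁|≡|u| = length-++-cancelʳ ρ₁ u (trans (cong length (sym P₁≡))
                 (trans (↭-length (↭-trans P₁↭ (↭-sym P₂↭))) (cong length P₂≡uxv)))
    P₁≡P₂ = trans P₁≡ (trans (cong (_++ _) (Successor-prefix s₁ P₁≡ P₁′≡ |ρ₁|≡|u| (lose h∈w₁ (here refl)))) (sym P₂≡uxv))

  pairGaps-disjoint : ∀ {P₁ P₁′ P₂ P₂′} → Successor P₁ P₁′ → P₂ <ₗ P₂′ → P₁′ ≤ₗ P₂ →
                      P₁ ↭ S → P₁′ ↭ S → P₂ ↭ S → P₂′ ↭ S → Disjoint (pairGaps P₁ P₁′) (pairGaps P₂ P₂′)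
  pairGaps-disjoint s₁ _ P₁′≤P₂ _ _ _ _ (here refl , here refl) =
    <ₗ-irrefl (<ₗ-≤ₗ-trans (Successor⇒<ₗ s₁) P₁′≤P₂)
  pairGaps-disjoint {P₂ = P₂} {P₂′} _ _ _ _ _ P₂↭ _ (here refl , there e∈) =
    ↭S⇒z∉ P₂↭ (subst (z ∈_) (map-proj₁-letterGaps P₂′ P₂) (∈-map⁺ proj₁ e∈))
  pairGaps-disjoint {P₁ = P₁} {P₁′} _ _ _ P₁↭ _ _ _ (there e∈ , here refl) =
    ↭S⇒z∉ P₁↭ (subst (z ∈_) (map-proj₁-letterGaps P₁′ P₁) (∈-map⁺ proj₁ e∈))
  pairGaps-disjoint {P₁ = P₁} {P₁′} {P₂} {P₂′} s₁ P₂<P₂′ P₁′≤P₂ P₁↭ P₁′↭ P₂↭ P₂′↭ (there e∈₁ , there e∈₂)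
    with ρ₁ , x , v , P₁≡ , refl ← ∈-letterGaps⁻ e∈₁ | ρ₂ , _ , v₂ , P₂≡ , e≡ ← ∈-letterGaps⁻ e∈₂
    with refl ← cong proj₁ e≡
    with refl , same-before ← ++-∷-injective-∉ v v₂ (↭S⇒z∉-suffix P₁↭ P₁≡) (↭S⇒z∉-suffix P₂↭ P₂≡) (cong proj₂ e≡)
    with w₁ , P₁′≡ ← before-split (↭S⇒∈ P₁↭ P₁′↭ P₁≡) | w₂ , P₂′≡ ← before-split (↭S⇒∈ P₁↭ P₂′↭ P₁≡) =
    no-shared-gap s₁ P₂<P₂′ P₁′≤P₂ P₁↭ P₁′↭ P₂↭ P₂′↭ P₁≡ P₂≡ P₁′≡
                  (trans P₂′≡ (cong (_++ x ∷ w₂) (sym same-before)))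

  ∈-blockGaps⁻ : ∀ {B Bs e} → Linked Successor (B ∷ Bs) → All (_↭ S) (B ∷ Bs) → e ∈ blockGaps (B ∷ Bs) →
                 ∃₂ λ P P′ → e ∈ pairGaps P P′ × B ≤ₗ P × Successor P P′ × P ↭ S × P′ ↭ S
  ∈-blockGaps⁻ {B} {B′ ∷ Bs} (s ∷ ss) (B↭ ∷ Bs↭@(B′↭ ∷ _)) e∈ with ∈-++⁻ (pairGaps B B′) e∈
  ... | inj₁ e∈₁ = B , B′ , e∈₁ , inj₁ refl , s , B↭ , B′↭
  ... | inj₂ e∈₂ with P , P′ , e∈′ , B′≤P , s′ , P↭ , P′↭ ← ∈-blockGaps⁻ ss Bs↭ e∈₂ =
    P , P′ , e∈′ , inj₂ (<ₗ-≤ₗ-trans (Successor⇒<ₗ s) B′≤P) , s′ , P↭ , P′↭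

  unique-blockGaps : ∀ {Bs} → Linked Successor Bs → All (_↭ S) Bs → Unique (blockGaps Bs)
  unique-blockGaps []  _ = []
  unique-blockGaps [-] _ = []
  unique-blockGaps {B ∷ B′ ∷ Bs} (s ∷ ss) (B↭ ∷ Bs↭@(B′↭ ∷ _)) =
    Unique.++⁺ (pairGaps-unique B↭) (unique-blockGaps ss Bs↭) later-disjoint
    where
    later-disjoint : Disjoint (pairGaps B B′) (blockGaps (B′ ∷ Bs))
    later-disjoint (e∈₁ , e∈₂) with P , P′ , e∈′ , B′≤P , s′ , P↭ , P′↭ ← ∈-blockGaps⁻ ss Bs↭ e∈₂ =
      pairGaps-disjoint s (Successor⇒<ₗ s′) B′≤P B↭ B′↭ P↭ P′↭ (e∈₁ , e∈′)

  unique-gaps-blockWord : ∀ {Bs} → Linked Successor Bs → All (_↭ S) Bs → Unique (gaps (blockWord Bs))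
  unique-gaps-blockWord {Bs} ss Bs↭ = subst Unique (sym (gaps-blockWord Bs Bs↭)) (unique-blockGaps ss Bs↭)

-- f(3, q) ≥ q!

Contains-++ʳ : ∀ {q k} {u : List (Fin q)} {P : List (Fin k)} v → Contains u P → Contains (u ++ v) P
Contains-++ʳ {P = P} v (σ , σ≢[] , u₁ , u₂ , refl) =
  σ , σ≢[] , u₁ , u₂ ++ v , trans (++-assoc u₁ _ v) (cong (u₁ ++_) (++-assoc (concatMap σ P) u₂ v))

module Z₃-free (s : ℕ) where

  open Permutations

  S : List (Fin (suc s))
  S = tabulate suc

  S↗ : AllPairs _<ᶠ_ S
  S↗ = AllPairs.tabulate⁺-< s<s

  |S| : length S ≡ s
  |S| = length-tabulate suc

  zero∉S : zero ∉ S
  zero∉S 0∈ with _ , () ← ∈-tabulate⁻ 0∈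

  open BlockWord _≟ᶠ_ <ᶠ-isStrictPartialOrder zero (AllPairs.map <ᶠ⇒≢ S↗) zero∉S
    using (blockWord; unique-gaps-blockWord)

  word : List (Fin (suc s))
  word = blockWord (permutations s S)

  length-word : length word ≡ suc s !
  length-word = begin
    length word                       ≡⟨ length-concatMap-const (zero ∷_) _ (All.tabulate |z∷P|) ⟩
    length (permutations s S) * suc s ≡⟨ cong (_* suc s) (length-permutations s |S|) ⟩
    s ! * suc s                       ≡⟨ *-comm (s !) (suc s) ⟩
    suc s !                           ∎
    where
    open ≡-Reasoning
    |z∷P| : ∀ {P} → P ∈ permutations s S → length (zero ∷ P) ≡ suc s
    |z∷P| P∈ = cong suc (trans (↭-length (∈-permutations⇒↭ s |S| P∈)) |S|)

  word-avoids-Z₃ : ¬ Contains word Z₃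
  word-avoids-Z₃ = unique-gaps⇒¬Z₃ word
    (unique-gaps-blockWord (linked-permutations <ᶠ-isStrictPartialOrder s S↗ |S|)
                           (All.tabulate (∈-permutations⇒↭ s |S|)))

  factorial≤f₃ : ∀ {n} → IsF3 (suc s) n → suc s ! ≤ n
  factorial≤f₃ {n} (all-contain , _) with n ≤? length word
  ... | no n≰  = ≤-trans (≤-reflexive (sym length-word)) (<⇒≤ (≰⇒> n≰))
  ... | yes n≤ = ⊥-elim (word-avoids-Z₃ (subst (λ w → Contains w Z₃) (take++drop≡id n word)
                   (Contains-++ʳ {P = Z₃} (drop n word) (all-contain (take n word) |take-n-word|))))
    where
    |take-n-word| : length (take n word) ≡ n
    |take-n-word| = trans (length-take n word) (m≤n⇒m⊓n≡m n≤)

-- q! ≥ q ^ (q - o(q))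

-- the largest e ≤ m with b ^ e ≤ F (0 if there is none)
largestPow≤ : ℕ → ℕ → ℕ → ℕ
largestPow≤ b F zero    = zero
largestPow≤ b F (suc m) with b ^ suc m ≤? F
... | yes _ = suc m
... | no  _ = largestPow≤ b F m

^-largestPow≤ : ∀ b {F} m → 1 ≤ F → b ^ largestPow≤ b F m ≤ F
^-largestPow≤ b     zero    1≤F = 1≤F
^-largestPow≤ b {F} (suc m) 1≤F with b ^ suc m ≤? F
... | yes ≤F = ≤F
... | no  _  = ^-largestPow≤ b m 1≤F

largestPow≤-≤ : ∀ b F m → largestPow≤ b F m ≤ m
largestPow≤-≤ b F zero    = z≤n
largestPow≤-≤ b F (suc m) with b ^ suc m ≤? F
... | yes _ = ≤-refl
... | no  _ = m≤n⇒m≤1+n (largestPow≤-≤ b F m)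

≤-largestPow≤ : ∀ b F {e} m → e ≤ m → b ^ e ≤ F → e ≤ largestPow≤ b F m
≤-largestPow≤ b F zero    z≤n _ = z≤n
≤-largestPow≤ b F {e} (suc m) e≤ ≤F with b ^ suc m ≤? F | m≤n⇒m<n∨m≡n e≤
... | yes _ | _         = e≤
... | no  _ | inj₁ e<   = ≤-largestPow≤ b F m (≤-pred e<) ≤F
... | no ≰F | inj₂ refl = contradiction ≤F ≰F

deficit : ℕ → ℕ
deficit q = q ∸ largestPow≤ q (q !) q

pow-deficit≤factorial : ∀ q → q ^ (q ∸ deficit q) ≤ q !
pow-deficit≤factorial q rewrite m∸[m∸n]≡n (largestPow≤-≤ q (q !) q) = ^-largestPow≤ q q (1≤n! q)

^-distribʳ-* : ∀ m n o → (m * n) ^ o ≡ m ^ o * n ^ o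
^-distribʳ-* m n zero    = refl
^-distribʳ-* m n (suc o) = trans (cong (m * n *_) (^-distribʳ-* m n o)) ([m*n]*[o*p]≡[m*o]*[n*p] m n (m ^ o) (n ^ o))

-- q! contains the q ∸ d factors q, q - 1, …, d + 1
[1+d]^[q∸d]≤q! : ∀ d q → d ≤ q → suc d ^ (q ∸ d) ≤ q !
[1+d]^[q∸d]≤q! d q d≤q with m≤n⇒m<n∨m≡n d≤q
... | inj₂ refl rewrite n∸n≡0 d = 1≤n! d
[1+d]^[q∸d]≤q! d (suc q) _ | inj₁ (s≤s d≤q) rewrite +-∸-assoc 1 d≤q =
  *-mono-≤ (s≤s d≤q) ([1+d]^[q∸d]≤q! d q d≤q)

-- With q ≈ K d and K ^ 2K ≤ d:
-- q ^ (q - 2d) ≤ K ^ (q - 2d) · (d + 1) ^ (q - 2d) ≤ (d + 1) ^ d · (d + 1) ^ (q - 2d) ≤ q!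
pow≤factorial : ∀ K d q .{{_ : NonZero K}} → K ^ (K + K) ≤ d → d + d ≤ q → q ≤ K * suc d →
                q ^ (q ∸ (d + d)) ≤ q !
pow≤factorial K d q E≤d 2d≤q q≤ = begin
  q ^ m                     ≤⟨ ^-monoˡ-≤ m q≤ ⟩
  (K * suc d) ^ m           ≡⟨ ^-distribʳ-* K (suc d) m ⟩
  K ^ m * suc d ^ m         ≤⟨ *-monoˡ-≤ (suc d ^ m) K^m≤ ⟩
  suc d ^ d * suc d ^ m     ≡⟨ ^-distribˡ-+-* (suc d) d m ⟨
  suc d ^ (d + m)           ≡⟨ cong (suc d ^_) d+m≡q∸d ⟩
  suc d ^ (q ∸ d)           ≤⟨ [1+d]^[q∸d]≤q! d q (≤-trans (m≤m+n d d) 2d≤q) ⟩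
  q !                       ∎
  where
  open ≤-Reasoning
  m = q ∸ (d + d)
  1≤d : 1 ≤ d
  1≤d = ≤-trans (m^n>0 K (K + K)) E≤d
  d+m≡q∸d : d + m ≡ q ∸ d
  d+m≡q∸d = trans (cong (d +_) (sym (∸-+-assoc q d d)))
                  (m+[n∸m]≡n (subst (_≤ q ∸ d) (m+n∸n≡m d d) (∸-monoˡ-≤ d 2d≤q)))
  K[1+d]≤2Kd : K * suc d ≤ (K + K) * d
  K[1+d]≤2Kd = begin
    K * suc d         ≡⟨ *-suc K d ⟩
    K + K * d         ≤⟨ +-monoˡ-≤ (K * d) (subst (_≤ K * d) (*-identityʳ K) (*-monoʳ-≤ K 1≤d)) ⟩
    K * d + K * d     ≡⟨ *-distribʳ-+ d K K ⟨
    (K + K) * d       ∎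
  K^m≤ : K ^ m ≤ suc d ^ d
  K^m≤ = begin
    K ^ m               ≤⟨ ^-monoʳ-≤ K (≤-trans (m∸n≤m q (d + d)) (≤-trans q≤ K[1+d]≤2Kd)) ⟩
    K ^ ((K + K) * d)   ≡⟨ ^-*-assoc K (K + K) d ⟨
    (K ^ (K + K)) ^ d   ≤⟨ ^-monoˡ-≤ d (m≤n⇒m≤1+n E≤d) ⟩
    suc d ^ d           ∎

-- For q ≥ K ^ 2K · K with K = 2k, d = ⌊q / K⌋ meets the hypotheses above, so deficit q ≤ 2d ≤ q / k.
deficit-littleO : LittleO-id deficit
deficit-littleO (suc k′) _ = K ^ (K + K) * K , bound
  where
  k = suc k′
  K = k + k
  bound : ∀ q → K ^ (K + K) * K ≤ q → k * deficit q ≤ q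
  bound q N≤q = begin
    k * deficit q   ≤⟨ *-monoʳ-≤ k deficit≤2d ⟩
    k * (d + d)     ≡⟨ *-distribˡ-+ k d d ⟩
    k * d + k * d   ≤⟨ 2kd≤q ⟩
    q               ∎
    where
    open ≤-Reasoning
    d = q / K
    2kd≤q : k * d + k * d ≤ q
    2kd≤q = subst (_≤ q) (trans (*-comm d K) (*-distribʳ-+ d k k)) (m/n*n≤m q K)
    E≤d : K ^ (K + K) ≤ d
    E≤d = subst (_≤ d) (m*n/n≡m (K ^ (K + K)) K) (/-monoˡ-≤ K N≤q)
    2d≤q : d + d ≤ q
    2d≤q = ≤-trans (+-mono-≤ (m≤n*m d k) (m≤n*m d k)) 2kd≤q
    q≤K[1+d] : q ≤ K * suc d
    q≤K[1+d] = begin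
      q                 ≡⟨ m≡m%n+[m/n]*n q K ⟩
      q % K + d * K     ≤⟨ +-monoˡ-≤ (d * K) (<⇒≤ (m%n<n q K)) ⟩
      suc d * K         ≡⟨ *-comm (suc d) K ⟩
      K * suc d         ∎
    deficit≤2d : deficit q ≤ d + d
    deficit≤2d = subst (deficit q ≤_) (m∸[m∸n]≡n 2d≤q)
                   (∸-monoʳ-≤ q (≤-largestPow≤ q (q !) q (m∸n≤m q (d + d))
                                  (pow≤factorial K d q E≤d 2d≤q q≤K[1+d])))

theorem3p2 : Σ (ℕ → ℕ) λ g → LittleO-id g ×
               ((q : ℕ) → 2 ≤ q → (n : ℕ) → IsF3 q n → q ^ (q ∸ g q) ≤ n)
theorem3p2 = deficit , deficit-littleO , bound
  where
  bound : (q : ℕ) → 2 ≤ q → (n : ℕ) → IsF3 q n → q ^ (q ∸ deficit q) ≤ n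
  bound (suc s) _ n isF3 = ≤-trans (pow-deficit≤factorial (suc s)) (Z₃-free.factorial≤f₃ s isF3)
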